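{- Let $0<\varepsilon\le 1/2$, let $n$ be sufficiently large, and let $t=t(n)<\varepsilon n/4$. Let $G$ be a bipartite graph with parts $X,Y$, $|X|=|Y|=n$, and $\delta(G)\ge(1/2+\varepsilon)n$, and let $M\subseteq G$ be a matching with $e(M)\ge n-t$. Then there exists a perfect matching $M'\subseteq G$ such that $|E(M')\cap E(M)|\ge n-2t$. -}

module Defs where

open import Data.Nat using (ℕ)
open import Data.Bool using (Bool; true; false; if_then_else_)
open import Data.Fin using (Fin)
open import Data.List using (List; map; allFin)
open import Data.Nat.ListAction using (sum)
open import Data.Product using (_×_; ∃)
open import Data.Integer using (+_)
open import Data.Rational using (ℚ; _/_)
open import Relation.Binary.PropositionalEquality using (_≡_)

-- A bipartite graph with parts X = Fin n and Y = Fin n is given by its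
-- bipartite adjacency relation: G x y ≡ true iff x ∈ X is adjacent to y ∈ Y.
BipGraph : ℕ → Set
BipGraph n = Fin n → Fin n → Bool

ℕ→ℚ : ℕ → ℚ
ℕ→ℚ k = + k / 1

indicator : Bool → ℕ
indicator b = if b then 1 else 0

degX : ∀ {n} → BipGraph n → Fin n → ℕ
degX {n} G x = sum (map (λ y → indicator (G x y)) (allFin n))

degY : ∀ {n} → BipGraph n → Fin n → ℕ
degY {n} G y = sum (map (λ x → indicator (G x y)) (allFin n))

MinDegAtLeast : ∀ {n} → BipGraph n → ℚ → Set
MinDegAtLeast G d = (∀ x → d Data.Rational.≤ ℕ→ℚ (degX G x))
                  × (∀ y → d Data.Rational.≤ ℕ→ℚ (degY G y))

edgeCount : ∀ {n} → BipGraph n → ℕ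
edgeCount {n} H = sum (map (λ x → sum (map (λ y → indicator (H x y)) (allFin n))) (allFin n))

_∩E_ : ∀ {n} → BipGraph n → BipGraph n → BipGraph n
(H ∩E K) x y = Data.Bool._∧_ (H x y) (K x y)

_⊆G_ : ∀ {n} → BipGraph n → BipGraph n → Set
H ⊆G G = ∀ x y → H x y ≡ true → G x y ≡ true

IsMatching : ∀ {n} → BipGraph n → Set
IsMatching M = (∀ x y y' → M x y ≡ true → M x y' ≡ true → y ≡ y')
             × (∀ x x' y → M x y ≡ true → M x' y ≡ true → x ≡ x')

IsPerfectMatching : ∀ {n} → BipGraph n → Set
IsPerfectMatching M = IsMatching M
                    × (∀ x → ∃ λ y → M x y ≡ true)
                    × (∀ y → ∃ λ x → M x y ≡ true)

module Submission where

-- Augment M along alternating paths of length three. If x ∈ X and y ∈ Y are both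
-- uncovered by a matching N, double counting shows that some edge x′y′ of N has y′
-- adjacent to x and x′ adjacent to y as soon as d(x) + d(y) + |N| > 2n; replacing x′y′
-- by x′y and xy′ enlarges N by one edge at the cost of one edge of N. Starting from M,
-- at most t such steps reach a perfect matching, which therefore keeps at least
-- |M| − t ≥ n − 2t edges of M. The degree bound gives d(x) + d(y) ≥ (1 + 2ε)n > n + t.

open import Defs

module BipartiteMatching where

  open import Data.Bool using (Bool; true; false; _∧_; _∨_; not)
  import Data.Bool.Properties as Bool
  open import Data.Empty using (⊥-elim)
  open import Data.Fin using (Fin; zero; suc)
  open import Data.Fin.Properties using (_≟_; any?; ¬∀⟶∃¬)
  import Data.Fin.Properties as Fin
  open import Data.List using (map; allFin; tabulate)
  open import Data.List.Properties using (map-tabulate)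
  open import Data.Nat using (ℕ; zero; suc; _+_; _*_; _∸_; _≤_; _<_; _≤?_; z≤n; s≤s)
  open import Data.Nat.ListAction using () renaming (sum to sumᴸ)
  open import Data.Nat.Properties hiding (_≟_)
  open import Algebra.Properties.Semiring.Sum +-*-semiring
    using (sum-syntax; sum-cong-≗; sum-replicate-zero; ∑-comm; ∑-distrib-+; *-distribˡ-sum)
  open import Data.Nat.Tactic.RingSolver using (solve-∀)
  open import Data.Product using (_×_; _,_; ∃; map₂)
  open import Data.Sum using (_⊎_; inj₁; inj₂)
  open import Function using (_∘_)
  open import Relation.Nullary using (¬_; Dec; yes; no; does; contradiction)
  open import Relation.Nullary.Decidable using (dec-true; dec-false; decidable-stable)
  open import Relation.Binary.PropositionalEquality

  private
    variable
      n : ℕ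
      a b x y : Fin n
      G H K : BipGraph n

  ∑-mono-≤ : {f g : Fin n → ℕ} → (∀ i → f i ≤ g i) → ∑[ i < n ] f i ≤ ∑[ i < n ] g i
  ∑-mono-≤ {zero}  f≤g = z≤n
  ∑-mono-≤ {suc n} f≤g = +-mono-≤ (f≤g zero) (∑-mono-≤ (f≤g ∘ suc))

  ∑-mono-< : {f g : Fin n → ℕ} (j : Fin n) → (∀ i → f i ≤ g i) → f j < g j →
             ∑[ i < n ] f i < ∑[ i < n ] g i
  ∑-mono-< zero    f≤g fj<gj = +-mono-<-≤ fj<gj (∑-mono-≤ (f≤g ∘ suc))
  ∑-mono-< (suc j) f≤g fj<gj = +-mono-≤-< (f≤g zero) (∑-mono-< j (f≤g ∘ suc) fj<gj)

  ∑-mono-≤-except : {f g : Fin n → ℕ} (j : Fin n) → (∀ i → i ≢ j → f i ≤ g i) →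
                    f j ≤ suc (g j) → ∑[ i < n ] f i ≤ suc (∑[ i < n ] g i)
  ∑-mono-≤-except zero f≤g fj≤1+gj =
    +-mono-≤ fj≤1+gj (∑-mono-≤ (λ i → f≤g (suc i) (λ ())))
  ∑-mono-≤-except {g = g} (suc j) f≤g fj≤1+gj = ≤-trans
    (+-mono-≤ (f≤g zero (λ ()))
      (∑-mono-≤-except j (λ i i≢j → f≤g (suc i) (i≢j ∘ Fin.suc-injective)) fj≤1+gj))
    (≤-reflexive (+-suc (g zero) _))

  summand≤∑ : (f : Fin n → ℕ) (j : Fin n) → f j ≤ ∑[ i < n ] f i
  summand≤∑ f zero    = m≤m+n (f zero) _
  summand≤∑ f (suc j) = ≤-trans (summand≤∑ (f ∘ suc) j) (m≤n+m _ (f zero))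

  ∑-pos⇒∃-pos : (f : Fin n → ℕ) → 0 < ∑[ i < n ] f i → ∃ λ i → 0 < f i
  ∑-pos⇒∃-pos {suc n} f ∑f>0 with f zero in f₀≡
  ... | suc _ = zero , subst (0 <_) (sym f₀≡) (s≤s z≤n)
  ... | zero  with ∑-pos⇒∃-pos (f ∘ suc) ∑f>0
  ...   | i , fi>0 = suc i , fi>0

  ∑-const-1 : ∀ n → ∑[ i < n ] 1 ≡ n
  ∑-const-1 zero    = refl
  ∑-const-1 (suc n) = cong suc (∑-const-1 n)

  sumᴸ-allFin : ∀ n (f : Fin n → ℕ) → sumᴸ (map f (allFin n)) ≡ ∑[ i < n ] f i
  sumᴸ-allFin n f = trans (cong sumᴸ (map-tabulate (λ i → i) f)) (sumᴸ-tabulate n f)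
    where
    sumᴸ-tabulate : ∀ n (f : Fin n → ℕ) → sumᴸ (tabulate f) ≡ ∑[ i < n ] f i
    sumᴸ-tabulate zero    f = refl
    sumᴸ-tabulate (suc n) f = cong (f zero +_) (sumᴸ-tabulate n (f ∘ suc))

  indicator≤1 : ∀ p → indicator p ≤ 1
  indicator≤1 true  = ≤-refl
  indicator≤1 false = z≤n

  indicator-mono : ∀ {p q} → (p ≡ true → q ≡ true) → indicator p ≤ indicator q
  indicator-mono {true}  p⇒q rewrite p⇒q refl = ≤-refl
  indicator-mono {false} p⇒q = z≤n

  indicator-true : ∀ {p} → p ≡ true → indicator p ≡ 1
  indicator-true refl = refl

  indicator-false : ∀ {p} → p ≢ true → indicator p ≡ 0
  indicator-false {true}  p≢true = contradiction refl p≢true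
  indicator-false {false} p≢true = refl

  indicator*≤ : ∀ p k → indicator p * k ≤ k
  indicator*≤ true  k = ≤-reflexive (*-identityˡ k)
  indicator*≤ false k = z≤n

  indicator-pos : ∀ {p} → 0 < indicator p → p ≡ true
  indicator-pos {true} _ = refl

  indicator*-pos : ∀ p k → 0 < indicator p * k → p ≡ true × 0 < k
  indicator*-pos true k pos = refl , subst (0 <_) (*-identityˡ k) pos

  ∑-indicator≤1 : (p : Fin n → Bool) → (∀ i j → p i ≡ true → p j ≡ true → i ≡ j) →
                  ∑[ i < n ] indicator (p i) ≤ 1
  ∑-indicator≤1 {zero}  p unique = z≤n
  ∑-indicator≤1 {suc n} p unique with p zero in p₀≡
  ... | false = ∑-indicator≤1 (p ∘ suc) (λ i j pi pj → Fin.suc-injective (unique (suc i) (suc j) pi pj))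
  ... | true  = s≤s (≤-reflexive (trans (sum-cong-≗ none-after-zero) (sum-replicate-zero n)))
    where
    none-after-zero : ∀ i → indicator (p (suc i)) ≡ 0
    none-after-zero i = indicator-false (λ pi → Fin.0≢1+n (unique zero (suc i) p₀≡ pi))

  ∑-inclusion-exclusion : (p : Fin n → Bool) (k : Fin n → ℕ) → (∀ i → k i ≤ 1) →
    ∑[ i < n ] indicator (p i) + ∑[ i < n ] k i ≤ ∑[ i < n ] (indicator (p i) * k i) + n
  ∑-inclusion-exclusion {n} p k k≤1 = begin
    ∑[ i < n ] indicator (p i) + ∑[ i < n ] k i        ≡⟨ ∑-distrib-+ (indicator ∘ p) k ⟨
    ∑[ i < n ] (indicator (p i) + k i)                 ≤⟨ ∑-mono-≤ pointwise ⟩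
    ∑[ i < n ] (indicator (p i) * k i + 1)             ≡⟨ ∑-distrib-+ (λ i → indicator (p i) * k i) (λ _ → 1) ⟩
    ∑[ i < n ] (indicator (p i) * k i) + ∑[ i < n ] 1  ≡⟨ cong (∑[ i < n ] (indicator (p i) * k i) +_) (∑-const-1 n) ⟩
    ∑[ i < n ] (indicator (p i) * k i) + n             ∎
    where
    open ≤-Reasoning
    pointwise : ∀ i → indicator (p i) + k i ≤ indicator (p i) * k i + 1
    pointwise i with p i
    ... | true  = ≤-reflexive (trans (+-comm 1 (k i)) (cong (_+ 1) (sym (*-identityˡ (k i)))))
    ... | false = k≤1 i

  deg : BipGraph n → Fin n → ℕ
  deg {n} H x = ∑[ y < n ] indicator (H x y)

  size : BipGraph n → ℕ
  size {n} H = ∑[ x < n ] deg H x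

  _ᵀ : BipGraph n → BipGraph n
  (H ᵀ) x y = H y x

  Covered : BipGraph n → Fin n → Set
  Covered H x = ∃ λ y → H x y ≡ true

  covered? : (H : BipGraph n) (x : Fin n) → Dec (Covered H x)
  covered? H x = any? (λ y → H x y Bool.≟ true)

  degX≡deg : (H : BipGraph n) (x : Fin n) → degX H x ≡ deg H x
  degX≡deg {n} H x = sumᴸ-allFin n (λ y → indicator (H x y))

  degY≡deg-ᵀ : (H : BipGraph n) (y : Fin n) → degY H y ≡ deg (H ᵀ) y
  degY≡deg-ᵀ {n} H y = sumᴸ-allFin n (λ x → indicator (H x y))

  edgeCount≡size : (H : BipGraph n) → edgeCount H ≡ size H
  edgeCount≡size {n} H = trans (sumᴸ-allFin n (degX H)) (sum-cong-≗ (degX≡deg H))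

  size-ᵀ : (H : BipGraph n) → size (H ᵀ) ≡ size H
  size-ᵀ {n} H = ∑-comm (λ y x → indicator (H x y))

  size-mono : H ⊆G K → size H ≤ size K
  size-mono H⊆K = ∑-mono-≤ (λ x → ∑-mono-≤ (λ y → indicator-mono (H⊆K x y)))

  size-mono-< : H ⊆G K → H a b ≢ true → K a b ≡ true → size H < size K
  size-mono-< {a = a} {b = b} H⊆K ab∉H ab∈K =
    ∑-mono-< a (λ x → ∑-mono-≤ (λ y → indicator-mono (H⊆K x y)))
      (∑-mono-< b (λ y → indicator-mono (H⊆K a y))
        (≤-reflexive (trans (cong suc (indicator-false ab∉H)) (sym (indicator-true ab∈K)))))

  ᵀ-isMatching : IsMatching H → IsMatching (H ᵀ)
  ᵀ-isMatching (rows , cols) = (λ y x x′ p q → cols x x′ y p q) , (λ y y′ x p q → rows x y y′ p q)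

  ⊆-isMatching : H ⊆G K → IsMatching K → IsMatching H
  ⊆-isMatching H⊆K (rows , cols) =
    (λ x y y′ p q → rows x y y′ (H⊆K x y p) (H⊆K x y′ q)) ,
    (λ x x′ y p q → cols x x′ y (H⊆K x y p) (H⊆K x′ y q))

  deg≤1 : IsMatching H → ∀ x → deg H x ≤ 1
  deg≤1 {H = H} (rows , _) x = ∑-indicator≤1 (H x) (rows x)

  uncovered⇒deg≡0 : ∀ {n} {H : BipGraph n} {x} → ¬ Covered H x → deg H x ≡ 0
  uncovered⇒deg≡0 {n} x-free =
    trans (sum-cong-≗ (λ y → indicator-false (λ xy∈H → x-free (y , xy∈H)))) (sum-replicate-zero n)

  uncovered⇒size<n : ∀ {n} {H : BipGraph n} {x} → IsMatching H → ¬ Covered H x → size H < n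
  uncovered⇒size<n {n} {H} {x} H-matching x-free = subst (size H <_) (∑-const-1 n)
    (∑-mono-< x (deg≤1 H-matching) (≤-reflexive (cong suc (uncovered⇒deg≡0 {H = H} x-free))))

  covered⇒n≤size : ∀ {n} {H : BipGraph n} → (∀ x → Covered H x) → n ≤ size H
  covered⇒n≤size {n} {H} all-covered = subst (_≤ size H) (∑-const-1 n) (∑-mono-≤ covered⇒1≤deg)
    where
    covered⇒1≤deg : ∀ x → 1 ≤ deg H x
    covered⇒1≤deg x with all-covered x
    ... | y , xy∈H = subst (_≤ deg H x) (indicator-true xy∈H) (summand≤∑ (λ y → indicator (H x y)) y)

  uncovered-vertex : ∀ {n} {H : BipGraph n} → size H < n → ∃ λ x → ¬ Covered H x
  uncovered-vertex {n} {H} size<n = ¬∀⟶∃¬ n (Covered H) (covered? H)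
    (λ all-covered → <⇒≱ size<n (covered⇒n≤size all-covered))

  isPerfectMatching : ∀ {n} {H : BipGraph n} → IsMatching H → n ≤ size H → IsPerfectMatching H
  isPerfectMatching {n} {H} H-matching n≤size =
    H-matching , all-covered H-matching n≤size ,
    all-covered (ᵀ-isMatching H-matching) (subst (_ ≤_) (sym (size-ᵀ H)) n≤size)
    where
    all-covered : ∀ {K : BipGraph n} → IsMatching K → n ≤ size K → ∀ x → Covered K x
    all-covered {K} K-matching n≤size x = decidable-stable (covered? K x)
      (λ x-free → <⇒≱ (uncovered⇒size<n K-matching x-free) n≤size)

  -- Opaque, so that unification sees these graphs rather than their Boolean unfoldings.
  opaque
    edge : Fin n → Fin n → BipGraph n
    edge a b x y = does (x ≟ a) ∧ does (y ≟ b)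

    _∪E_ : BipGraph n → BipGraph n → BipGraph n
    (H ∪E K) x y = H x y ∨ K x y

    _∖E_ : BipGraph n → BipGraph n → BipGraph n
    (H ∖E K) x y = H x y ∧ not (K x y)

    edge-self : edge a b a b ≡ true
    edge-self {a = a} {b = b} = cong₂ _∧_ (dec-true (a ≟ a) refl) (dec-true (b ≟ b) refl)

    edge⇒≡ : edge a b x y ≡ true → x ≡ a × y ≡ b
    edge⇒≡ {a = a} {b = b} {x = x} {y = y} e with x ≟ a | y ≟ b
    ... | yes x≡a | yes y≡b = x≡a , y≡b
    edge⇒≡ () | yes _ | no _
    edge⇒≡ () | no _  | _

    edge-offˡ : x ≢ a → edge a b x y ≡ false
    edge-offˡ {x = x} {a = a} x≢a rewrite dec-false (x ≟ a) x≢a = refl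

    edge-offʳ : y ≢ b → edge a b x y ≡ false
    edge-offʳ {y = y} {b = b} {a = a} {x = x} y≢b rewrite dec-false (y ≟ b) y≢b =
      Bool.∧-zeroʳ (does (x ≟ a))

    ⊆-∪Eˡ : H ⊆G (H ∪E K)
    ⊆-∪Eˡ x y xy∈H rewrite xy∈H = refl

    ⊆-∪Eʳ : K ⊆G (H ∪E K)
    ⊆-∪Eʳ {H = H} x y xy∈K rewrite xy∈K = Bool.∨-zeroʳ (H x y)

    ∪E-cases : (H ∪E K) x y ≡ true → H x y ≡ true ⊎ K x y ≡ true
    ∪E-cases {H = H} {x = x} {y = y} e with H x y
    ... | true  = inj₁ refl
    ... | false = inj₂ e

    ∖E-⊆ : (H ∖E K) ⊆G H
    ∖E-⊆ x y = Bool.∧-conicalˡ _ _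

    ∖E⇒∉ : (H ∖E K) x y ≡ true → K x y ≢ true
    ∖E⇒∉ e = not≡true⇒≢true (Bool.∧-conicalʳ _ _ e)
      where
      not≡true⇒≢true : ∀ {p} → not p ≡ true → p ≢ true
      not≡true⇒≢true {false} _ ()

    ∖E-outside : K x y ≡ false → (H ∖E K) x y ≡ H x y
    ∖E-outside {K = K} {x = x} {y = y} {H = H} xy∉K rewrite xy∉K = Bool.∧-identityʳ (H x y)

    ∖E-∩E-⊆ : ((H ∩E G) ∖E K) ⊆G ((H ∖E K) ∩E G)
    ∖E-∩E-⊆ {H = H} {G = G} {K = K} x y e with H x y | G x y | K x y
    ... | true | true | false = refl
    ∖E-∩E-⊆ x y () | false | _     | _
    ∖E-∩E-⊆ x y () | true  | false | _
    ∖E-∩E-⊆ x y () | true  | true  | true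

  ∩E-monoˡ : H ⊆G K → (H ∩E G) ⊆G (K ∩E G)
  ∩E-monoˡ H⊆K x y e = cong₂ _∧_ (H⊆K x y (Bool.∧-conicalˡ _ _ e)) (Bool.∧-conicalʳ _ _ e)

  edge-⊆ : G a b ≡ true → edge a b ⊆G G
  edge-⊆ ab∈G x y e with edge⇒≡ e
  ... | refl , refl = ab∈G

  ∪E-⊆ : H ⊆G G → K ⊆G G → (H ∪E K) ⊆G G
  ∪E-⊆ H⊆G K⊆G x y e with ∪E-cases e
  ... | inj₁ xy∈H = H⊆G x y xy∈H
  ... | inj₂ xy∈K = K⊆G x y xy∈K

  ∪E-edge-cases : (H ∪E edge a b) x y ≡ true → H x y ≡ true ⊎ (x ≡ a × y ≡ b)
  ∪E-edge-cases e with ∪E-cases e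
  ... | inj₁ xy∈H = inj₁ xy∈H
  ... | inj₂ xy∈e = inj₂ (edge⇒≡ xy∈e)

  ⊆-uncovered : H ⊆G K → ¬ Covered K x → ¬ Covered H x
  ⊆-uncovered H⊆K x-free (y , xy∈H) = x-free (y , H⊆K _ y xy∈H)

  ⊆-uncoveredᵀ : H ⊆G K → ¬ Covered (K ᵀ) y → ¬ Covered (H ᵀ) y
  ⊆-uncoveredᵀ H⊆K y-free (x , xy∈H) = y-free (x , H⊆K x _ xy∈H)

  ∪E-edge-uncovered : ¬ Covered H x → x ≢ a → ¬ Covered (H ∪E edge a b) x
  ∪E-edge-uncovered x-free x≢a (y , e) with ∪E-edge-cases e
  ... | inj₁ xy∈H      = x-free (y , xy∈H)
  ... | inj₂ (x≡a , _) = x≢a x≡a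

  ∪E-edge-uncoveredᵀ : ¬ Covered (H ᵀ) y → y ≢ b → ¬ Covered ((H ∪E edge a b) ᵀ) y
  ∪E-edge-uncoveredᵀ y-free y≢b (x , e) with ∪E-edge-cases e
  ... | inj₁ xy∈H      = y-free (x , xy∈H)
  ... | inj₂ (_ , y≡b) = y≢b y≡b

  ∖E-edge-uncovered : IsMatching H → H a b ≡ true → ¬ Covered (H ∖E edge a b) a
  ∖E-edge-uncovered (rows , _) ab∈H (y , e) with rows _ _ y ab∈H (∖E-⊆ _ y e)
  ... | refl = ∖E⇒∉ e edge-self

  ∖E-edge-uncoveredᵀ : IsMatching H → H a b ≡ true → ¬ Covered ((H ∖E edge a b) ᵀ) b
  ∖E-edge-uncoveredᵀ (_ , cols) ab∈H (x , e) with cols _ x _ ab∈H (∖E-⊆ x _ e)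
  ... | refl = ∖E⇒∉ e edge-self

  ∪E-edge-isMatching : IsMatching H → ¬ Covered H a → ¬ Covered (H ᵀ) b → IsMatching (H ∪E edge a b)
  ∪E-edge-isMatching {H = H} {a = a} {b = b} (rows , cols) a-free b-free = rows′ , cols′
    where
    rows′ : ∀ x y y′ → (H ∪E edge a b) x y ≡ true → (H ∪E edge a b) x y′ ≡ true → y ≡ y′
    rows′ x y y′ e e′ with ∪E-edge-cases e | ∪E-edge-cases e′
    ... | inj₁ xy∈H       | inj₁ xy′∈H       = rows x y y′ xy∈H xy′∈H
    ... | inj₁ xy∈H       | inj₂ (refl , _)  = ⊥-elim (a-free (y , xy∈H))
    ... | inj₂ (refl , _) | inj₁ xy′∈H       = ⊥-elim (a-free (y′ , xy′∈H))
    ... | inj₂ (_ , refl) | inj₂ (_ , refl)  = refl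
    cols′ : ∀ x x′ y → (H ∪E edge a b) x y ≡ true → (H ∪E edge a b) x′ y ≡ true → x ≡ x′
    cols′ x x′ y e e′ with ∪E-edge-cases e | ∪E-edge-cases e′
    ... | inj₁ xy∈H       | inj₁ x′y∈H       = cols x x′ y xy∈H x′y∈H
    ... | inj₁ xy∈H       | inj₂ (_ , refl)  = ⊥-elim (b-free (x , xy∈H))
    ... | inj₂ (_ , refl) | inj₁ x′y∈H       = ⊥-elim (b-free (x′ , x′y∈H))
    ... | inj₂ (refl , _) | inj₂ (refl , _)  = refl

  size-∖E-edge : size H ≤ suc (size (H ∖E edge a b))
  size-∖E-edge {H = H} {a = a} {b = b} =
    ∑-mono-≤-except a (λ x x≢a → ∑-mono-≤ (λ y → unchanged {x} {y} (edge-offˡ x≢a)))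
      (∑-mono-≤-except b (λ y y≢b → unchanged {a} {y} (edge-offʳ y≢b))
        (≤-trans (indicator≤1 (H a b)) (s≤s z≤n)))
    where
    unchanged : ∀ {x y} → edge a b x y ≡ false → indicator (H x y) ≤ indicator ((H ∖E edge a b) x y)
    unchanged xy∉e = ≤-reflexive (cong indicator (sym (∖E-outside xy∉e)))

  augment : BipGraph n → (x y′ x′ y : Fin n) → BipGraph n
  augment N x y′ x′ y = ((N ∖E edge x′ y′) ∪E edge x′ y) ∪E edge x y′

  augment-⊆G : ∀ {n} {G N : BipGraph n} {x y′ x′ y} → N ⊆G G →
               G x y′ ≡ true → G x′ y ≡ true → augment N x y′ x′ y ⊆G G
  augment-⊆G N⊆G xy′∈G x′y∈G =
    ∪E-⊆ (∪E-⊆ (λ u v → N⊆G u v ∘ ∖E-⊆ u v) (edge-⊆ x′y∈G)) (edge-⊆ xy′∈G)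

  module Augmentation {n} {N : BipGraph n} {x y′ x′ y : Fin n} (N-matching : IsMatching N)
    (x-free : ¬ Covered N x) (y-free : ¬ Covered (N ᵀ) y) (x′y′∈N : N x′ y′ ≡ true) where

    private
      N₁ N₂ : BipGraph n
      N₁ = N ∖E edge x′ y′
      N₂ = N₁ ∪E edge x′ y

      N₁⊆N : N₁ ⊆G N
      N₁⊆N = ∖E-⊆

      x-free₁ : ¬ Covered N₁ x
      x-free₁ = ⊆-uncovered N₁⊆N x-free

      y-free₁ : ¬ Covered (N₁ ᵀ) y
      y-free₁ = ⊆-uncoveredᵀ N₁⊆N y-free

      x-free₂ : ¬ Covered N₂ x
      x-free₂ = ∪E-edge-uncovered x-free₁ (λ { refl → x-free (y′ , x′y′∈N) })

      y′-free₂ : ¬ Covered (N₂ ᵀ) y′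
      y′-free₂ = ∪E-edge-uncoveredᵀ (∖E-edge-uncoveredᵀ N-matching x′y′∈N)
        (λ { refl → y-free (x′ , x′y′∈N) })

      N₂-matching : IsMatching N₂
      N₂-matching = ∪E-edge-isMatching (⊆-isMatching N₁⊆N N-matching)
        (∖E-edge-uncovered N-matching x′y′∈N) y-free₁

    augment-isMatching : IsMatching (augment N x y′ x′ y)
    augment-isMatching = ∪E-edge-isMatching N₂-matching x-free₂ y′-free₂

    augment-size : size N < size (augment N x y′ x′ y)
    augment-size = begin-strict
      size N                      ≤⟨ size-∖E-edge {a = x′} {b = y′} ⟩
      suc (size N₁)               ≤⟨ size-mono-< (⊆-∪Eˡ {K = edge x′ y}) x′y∉N₁ (⊆-∪Eʳ x′ y edge-self) ⟩
      size N₂                     <⟨ size-mono-< (⊆-∪Eˡ {K = edge x y′}) xy′∉N₂ (⊆-∪Eʳ x y′ edge-self) ⟩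
      size (augment N x y′ x′ y)  ∎
      where
      open ≤-Reasoning
      x′y∉N₁ : N₁ x′ y ≢ true
      x′y∉N₁ x′y∈N₁ = y-free₁ (x′ , x′y∈N₁)
      xy′∉N₂ : N₂ x y′ ≢ true
      xy′∉N₂ xy′∈N₂ = x-free₂ (y′ , xy′∈N₂)

    augment-∩E : ∀ M → size (N ∩E M) ≤ suc (size (augment N x y′ x′ y ∩E M))
    augment-∩E M = ≤-trans (size-∖E-edge {a = x′} {b = y′}) (s≤s (size-mono kept))
      where
      kept : ((N ∩E M) ∖E edge x′ y′) ⊆G (augment N x y′ x′ y ∩E M)
      kept u v = ∩E-monoˡ {G = M} (λ u v → ⊆-∪Eˡ u v ∘ ⊆-∪Eˡ u v) u v ∘ ∖E-∩E-⊆ {H = N} {G = M} u v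

  #alternating-paths : BipGraph n → BipGraph n → Fin n → Fin n → ℕ
  #alternating-paths {n} G N x y =
    ∑[ x′ < n ] (indicator (G x′ y) * ∑[ y′ < n ] (indicator (G x y′) * indicator (N x′ y′)))

  #alternating-paths-pos : ∀ {n} {G N : BipGraph n} {x y} → IsMatching N →
    n + n < deg G x + deg (G ᵀ) y + size N → 0 < #alternating-paths G N x y
  #alternating-paths-pos {n} {G} {N} {x} {y} N-matching dense = +-cancelˡ-< (P + (n + n)) 0 R (begin-strict
    P + (n + n) + 0                         ≡⟨ +-identityʳ _ ⟩
    P + (n + n)                             <⟨ +-monoʳ-< P dense ⟩
    P + (deg G x + deg (G ᵀ) y + size N)    ≡⟨ regroup₁ P (deg G x) (deg (G ᵀ) y) (size N) ⟩
    (deg G x + size N) + (deg (G ᵀ) y + P)  ≤⟨ +-mono-≤ Y-count X-count ⟩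
    (P + n) + (R + n)                       ≡⟨ regroup₂ P n R ⟩
    P + (n + n) + R                         ∎)
    where
    open ≤-Reasoning

    regroup₁ : ∀ p a b s → p + (a + b + s) ≡ (a + s) + (b + p)
    regroup₁ = solve-∀

    regroup₂ : ∀ p n r → (p + n) + (r + n) ≡ p + (n + n) + r
    regroup₂ = solve-∀

    N[x] : Fin n → ℕ
    N[x] x′ = ∑[ y′ < n ] (indicator (G x y′) * indicator (N x′ y′))

    P R : ℕ
    P = ∑[ x′ < n ] N[x] x′
    R = #alternating-paths G N x y

    Y-count : deg G x + size N ≤ P + n
    Y-count = begin
      deg G x + size N                                    ≡⟨ cong (deg G x +_) (size-ᵀ N) ⟨
      deg G x + ∑[ y′ < n ] deg (N ᵀ) y′                  ≤⟨ ∑-inclusion-exclusion (G x) (deg (N ᵀ)) (deg≤1 (ᵀ-isMatching N-matching)) ⟩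
      ∑[ y′ < n ] (indicator (G x y′) * deg (N ᵀ) y′) + n ≡⟨ cong (_+ n) double-count ⟩
      P + n                                               ∎
      where
      double-count : ∑[ y′ < n ] (indicator (G x y′) * deg (N ᵀ) y′) ≡ P
      double-count = trans
        (sum-cong-≗ (λ y′ → *-distribˡ-sum (indicator (G x y′)) (λ x′ → indicator (N x′ y′))))
        (∑-comm (λ y′ x′ → indicator (G x y′) * indicator (N x′ y′)))

    X-count : deg (G ᵀ) y + P ≤ R + n
    X-count = ∑-inclusion-exclusion (λ x′ → G x′ y) N[x]
      (λ x′ → ≤-trans (∑-mono-≤ (λ y′ → indicator*≤ (G x y′) _)) (deg≤1 N-matching x′))

  alternating-edge : ∀ {n} {G N : BipGraph n} {x y} → IsMatching N →
    n + n < deg G x + deg (G ᵀ) y + size N →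
    ∃ λ x′ → ∃ λ y′ → N x′ y′ ≡ true × G x y′ ≡ true × G x′ y ≡ true
  alternating-edge {n} {G} {N} {x} {y} N-matching dense
    with ∑-pos⇒∃-pos _ (#alternating-paths-pos {G = G} N-matching dense)
  ... | x′ , pos₁ with indicator*-pos (G x′ y) _ pos₁
  ... | x′y∈G , pos₂ with ∑-pos⇒∃-pos _ pos₂
  ... | y′ , pos₃ with indicator*-pos (G x y′) _ pos₃
  ... | xy′∈G , pos₄ = x′ , y′ , indicator-pos pos₄ , xy′∈G , x′y∈G

  -- The last field says that N′ drops at most one edge of N.
  Enlarges : BipGraph n → BipGraph n → BipGraph n → Set
  Enlarges G N N′ =
    N′ ⊆G G × IsMatching N′ × size N < size N′ × (∀ M → size (N ∩E M) ≤ suc (size (N′ ∩E M)))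

  augment-enlarges : ∀ {n} {G N : BipGraph n} {x y} → N ⊆G G → IsMatching N →
    ¬ Covered N x → ¬ Covered (N ᵀ) y →
    (∃ λ x′ → ∃ λ y′ → N x′ y′ ≡ true × G x y′ ≡ true × G x′ y ≡ true) → ∃ (Enlarges G N)
  augment-enlarges {N = N} {x} {y} N⊆G N-matching x-free y-free (x′ , y′ , x′y′∈N , xy′∈G , x′y∈G) =
    augment N x y′ x′ y , augment-⊆G N⊆G xy′∈G x′y∈G , augment-isMatching , augment-size , augment-∩E
    where open Augmentation N-matching x-free y-free x′y′∈N

  augmenting-step : ∀ {n} {G N : BipGraph n} → N ⊆G G → IsMatching N → size N < n →
    (∀ x y → n + n < deg G x + deg (G ᵀ) y + size N) → ∃ (Enlarges G N)
  augmenting-step {n} {G} {N} N⊆G N-matching N<n dense =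
    between (uncovered-vertex N<n) (uncovered-vertex (subst (_< n) (sym (size-ᵀ N)) N<n))
    where
    between : (∃ λ x → ¬ Covered N x) → (∃ λ y → ¬ Covered (N ᵀ) y) → ∃ (Enlarges G N)
    between (x , x-free) (y , y-free) =
      augment-enlarges N⊆G N-matching x-free y-free (alternating-edge {G = G} N-matching (dense x y))

  m≤o+k⇒m+k<d⇒m+m<d+o : ∀ {m o k d} → m ≤ o + k → m + k < d → m + m < d + o
  m≤o+k⇒m+k<d⇒m+m<d+o {m} {o} {k} {d} m≤o+k m+k<d = begin-strict
    m + m        ≤⟨ +-monoʳ-≤ m m≤o+k ⟩
    m + (o + k)  ≡⟨ regroup m o k ⟩
    (m + k) + o  <⟨ +-monoˡ-< o m+k<d ⟩
    d + o        ∎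
    where
    open ≤-Reasoning
    regroup : ∀ m o k → m + (o + k) ≡ (m + k) + o
    regroup = solve-∀

  extend-to-perfect : ∀ {n} {G : BipGraph n} (M : BipGraph n) k (N : BipGraph n) → N ⊆G G → IsMatching N →
    n ≤ size N + k → (∀ x y → n + k < deg G x + deg (G ᵀ) y) →
    ∃ λ M′ → M′ ⊆G G × IsPerfectMatching M′ × size (N ∩E M) ≤ size (M′ ∩E M) + k
  extend-to-perfect {n} M zero N N⊆G N-matching n≤N+0 _ =
    N , N⊆G , isPerfectMatching N-matching (subst (n ≤_) (+-identityʳ (size N)) n≤N+0) , m≤m+n _ 0
  extend-to-perfect {n} {G} M (suc k) N N⊆G N-matching n≤N+1+k dense = by-cases (n ≤? size N)
    where
    by-cases : Dec (n ≤ size N) →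
      ∃ λ M′ → M′ ⊆G G × IsPerfectMatching M′ × size (N ∩E M) ≤ size (M′ ∩E M) + suc k
    by-cases (yes n≤N) = N , N⊆G , isPerfectMatching N-matching n≤N , m≤m+n _ (suc k)
    by-cases (no n≰N)  = continue
      (augmenting-step N⊆G N-matching (≰⇒> n≰N) (λ x y → m≤o+k⇒m+k<d⇒m+m<d+o n≤N+1+k (dense x y)))
      where
      continue : ∃ (Enlarges G N) →
        ∃ λ M′ → M′ ⊆G G × IsPerfectMatching M′ × size (N ∩E M) ≤ size (M′ ∩E M) + suc k
      continue (N′ , N′⊆G , N′-matching , N<N′ , N∩M≤1+N′∩M) =
        map₂ (map₂ (map₂ λ N′∩M≤M′∩M+k →
               ≤-trans (N∩M≤1+N′∩M M) (≤-trans (s≤s N′∩M≤M′∩M+k) (≤-reflexive (sym (+-suc _ k))))))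
          (extend-to-perfect M k N′ N′⊆G N′-matching
             (≤-trans n≤N+1+k (≤-trans (≤-reflexive (+-suc (size N) k)) (+-monoˡ-≤ k N<N′)))
             (λ x y → <-trans (+-monoʳ-< n (n<1+n k)) (dense x y)))

  size-∩E-idem : (H : BipGraph n) → size (H ∩E H) ≡ size H
  size-∩E-idem H = sum-cong-≗ (λ x → sum-cong-≗ (λ y → cong indicator (Bool.∧-idem (H x y))))

  perfect-matching-near : ∀ {n} {G M : BipGraph n} t → M ⊆G G → IsMatching M → n ∸ t ≤ edgeCount M →
    (∀ x y → n + t < degX G x + degY G y) →
    ∃ λ M′ → M′ ⊆G G × IsPerfectMatching M′ × n ∸ (2 * t) ≤ edgeCount (M′ ∩E M)
  perfect-matching-near {n} {G} {M} t M⊆G M-matching n∸t≤M dense =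
    keep-edges (extend-to-perfect M t M M⊆G M-matching n≤M+t dense′)
    where
    n∸t≤size : n ∸ t ≤ size M
    n∸t≤size = subst (n ∸ t ≤_) (edgeCount≡size M) n∸t≤M

    n≤M+t : n ≤ size M + t
    n≤M+t = ≤-trans (m≤n+m∸n n t) (≤-trans (+-monoʳ-≤ t n∸t≤size) (≤-reflexive (+-comm t (size M))))

    dense′ : ∀ x y → n + t < deg G x + deg (G ᵀ) y
    dense′ x y = subst₂ (λ a b → n + t < a + b) (degX≡deg G x) (degY≡deg-ᵀ G y) (dense x y)

    keep-edges : (∃ λ M′ → M′ ⊆G G × IsPerfectMatching M′ × size (M ∩E M) ≤ size (M′ ∩E M) + t) →
                 ∃ λ M′ → M′ ⊆G G × IsPerfectMatching M′ × n ∸ (2 * t) ≤ edgeCount (M′ ∩E M)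
    keep-edges (M′ , M′⊆G , M′-perfect , M≤M′∩M+t) = M′ , M′⊆G , M′-perfect , (begin
      n ∸ (2 * t)          ≡⟨ cong (λ s → n ∸ (t + s)) (+-identityʳ t) ⟩
      n ∸ (t + t)          ≡⟨ ∸-+-assoc n t t ⟨
      n ∸ t ∸ t            ≤⟨ ∸-monoˡ-≤ t n∸t≤size ⟩
      size M ∸ t           ≤⟨ m≤n+o⇒m∸n≤o (size M) t M≤t+M′∩M ⟩
      size (M′ ∩E M)       ≡⟨ edgeCount≡size (M′ ∩E M) ⟨
      edgeCount (M′ ∩E M)  ∎)
      where
      open ≤-Reasoning
      M≤t+M′∩M : size M ≤ t + size (M′ ∩E M)
      M≤t+M′∩M = subst₂ _≤_ (size-∩E-idem M) (+-comm _ t) M≤M′∩M+t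

module DegreeCondition where

  open import Data.Integer using (+_)
  import Data.Integer as ℤ
  import Data.Integer.Properties as ℤ
  open import Data.Nat using (ℕ)
  import Data.Nat as ℕ
  open import Data.Nat.Coprimality using (Coprime; 1-coprimeTo)
  import Data.Nat.Coprimality as Coprime
  open import Data.Rational using (ℚ; mkℚ; _/_; _+_; _*_; _≤_; _<_; ½; 0ℚ; NonNegative; positive)
  import Data.Rational.Properties as ℚ
  open import Data.Rational.Solver using (module +-*-Solver)
  open import Relation.Binary.PropositionalEquality

  private
    coprime-1 : ∀ k → Coprime k 1
    coprime-1 k = Coprime.sym (1-coprimeTo k)

    ℕ→ℚ≡mkℚ : ∀ k → ℕ→ℚ k ≡ mkℚ (+ k) 0 (coprime-1 k)
    ℕ→ℚ≡mkℚ k = ℚ.normalize-coprime (coprime-1 k)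

  ℕ→ℚ-homo-+ : ∀ a b → ℕ→ℚ (a ℕ.+ b) ≡ ℕ→ℚ a + ℕ→ℚ b
  ℕ→ℚ-homo-+ a b rewrite ℕ→ℚ≡mkℚ a | ℕ→ℚ≡mkℚ b =
    sym (ℚ./-cong {p₁ = + a ℤ.* + 1 ℤ.+ + b ℤ.* + 1} {q₁ = 1} {p₂ = + (a ℕ.+ b)} {q₂ = 1}
      (cong₂ ℤ._+_ (ℤ.*-identityʳ (+ a)) (ℤ.*-identityʳ (+ b))) refl)

  ℕ→ℚ-cancel-< : ∀ {a b} → ℕ→ℚ a < ℕ→ℚ b → a ℕ.< b
  ℕ→ℚ-cancel-< {a} {b} a<b rewrite ℕ→ℚ≡mkℚ a | ℕ→ℚ≡mkℚ b with ℚ.drop-*<* a<b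
  ... | a*1<b*1 rewrite ℤ.*-identityʳ (+ a) | ℤ.*-identityʳ (+ b) with a*1<b*1
  ...   | ℤ.+<+ a<b′ = a<b′

  n+t<deg+deg : ∀ {ε} → 0ℚ < ε → ∀ n t a b → ℕ→ℚ t < (ε * ℕ→ℚ n) * (+ 1 / 4) →
    (½ + ε) * ℕ→ℚ n ≤ ℕ→ℚ a → (½ + ε) * ℕ→ℚ n ≤ ℕ→ℚ b → n ℕ.+ t ℕ.< a ℕ.+ b
  n+t<deg+deg {ε} ε>0 n t a b t<εn/4 deg-a deg-b = ℕ→ℚ-cancel-< (begin-strict
    ℕ→ℚ (n ℕ.+ t)                          ≡⟨ ℕ→ℚ-homo-+ n t ⟩
    N + ℕ→ℚ t                              <⟨ ℚ.+-monoʳ-< N t<εn/4 ⟩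
    N + εN * (+ 1 / 4)                     ≡⟨ cong (λ q → N + q) (ℚ.+-identityʳ _) ⟨
    N + (εN * (+ 1 / 4) + 0ℚ)              ≤⟨ ℚ.+-monoʳ-≤ N (ℚ.+-monoʳ-≤ (εN * (+ 1 / 4)) 0≤7εN/4) ⟩
    N + (εN * (+ 1 / 4) + εN * (+ 7 / 4))  ≡⟨ rearrange ε N ⟩
    (½ + ε) * N + (½ + ε) * N              ≤⟨ ℚ.+-mono-≤ deg-a deg-b ⟩
    ℕ→ℚ a + ℕ→ℚ b                          ≡⟨ ℕ→ℚ-homo-+ a b ⟨
    ℕ→ℚ (a ℕ.+ b)                          ∎)
    where
    open ℚ.≤-Reasoning
    N εN : ℚ
    N = ℕ→ℚ n
    εN = ε * N

    instance
      ε-nonNeg : NonNegative ε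
      ε-nonNeg = ℚ.pos⇒nonNeg ε {{positive ε>0}}
      N-nonNeg : NonNegative N
      N-nonNeg = ℚ.normalize-nonNeg n 1
      εN-nonNeg : NonNegative εN
      εN-nonNeg = ℚ.nonNeg*nonNeg⇒nonNeg ε N

    0≤7εN/4 : 0ℚ ≤ εN * (+ 7 / 4)
    0≤7εN/4 = ℚ.nonNegative⁻¹ _ {{ℚ.nonNeg*nonNeg⇒nonNeg εN (+ 7 / 4)}}

    rearrange : ∀ ε N → N + (ε * N * (+ 1 / 4) + ε * N * (+ 7 / 4)) ≡ (½ + ε) * N + (½ + ε) * N
    rearrange = solve 2 (λ ε N → N :+ (ε :* N :* con (+ 1 / 4) :+ ε :* N :* con (+ 7 / 4))
                            := (con ½ :+ ε) :* N :+ (con ½ :+ ε) :* N) refl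
      where open +-*-Solver

open import Data.Nat using (ℕ; _≤_; _∸_)
open import Data.Integer using (+_)
open import Data.Rational using (ℚ; _/_; _+_; _*_; _<_; ½; 0ℚ)
open import Data.Product using (_×_; ∃; _,_; proj₁; proj₂)
open BipartiteMatching using (perfect-matching-near)
open DegreeCondition using (n+t<deg+deg)

lemma3p3 : (ε : ℚ) → 0ℚ < ε → ε Data.Rational.≤ ½ →
    ∃ λ (n₀ : ℕ) → ∀ (n : ℕ) → n₀ ≤ n →
    ∀ (t : ℕ) → ℕ→ℚ t < (ε * ℕ→ℚ n) * (+ 1 / 4) →
    ∀ (G : BipGraph n) → MinDegAtLeast G ((½ + ε) * ℕ→ℚ n) →
    ∀ (M : BipGraph n) → M ⊆G G → IsMatching M → n ∸ t ≤ edgeCount M →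
    ∃ λ (M' : BipGraph n) → M' ⊆G G × IsPerfectMatching M'
      × n ∸ (2 Data.Nat.* t) ≤ edgeCount (M' ∩E M)
lemma3p3 ε ε>0 _ = 0 , λ n _ t t<εn/4 G minDeg M M⊆G M-matching n∸t≤M →
  perfect-matching-near t M⊆G M-matching n∸t≤M
    (λ x y → n+t<deg+deg ε>0 n t (degX G x) (degY G y) t<εn/4 (proj₁ minDeg x) (proj₂ minDeg y))
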